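{- For every $n\ge 1$, the path $P_n$ on $n$ vertices has a $\gamma^{p}_{I}(P_n)$-function $f=(V_0,V_1,V_2)$ with $V_2=\emptyset$.
   Context: All graphs are finite and simple. A perfect Italian dominating function (PID-function) of a graph $G$ is a function $f:V(G)\to\{0,1,2\}$ such that for every vertex $v$ with $f(v)=0$ we have $\sum_{u\in N(v)}f(u)=2$, where $N(v)$ is the open neighborhood of $v$. Its weight is $f(V)=\sum_{u\in V(G)}f(u)$. The perfect Italian domination number $\gamma^{p}_{I}(G)$ is the minimum weight of a PID-function of $G$, and a PID-function of weight $\gamma^{p}_{I}(G)$ is called a $\gamma^{p}_{I}(G)$-function. A function $f:V\to\{0,1,2\}$ is written $f=(V_0,V_1,V_2)$ where $V_i=\{v: f(v)=i\}$. -}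

module Defs where

open import Data.Nat using (ℕ; zero; suc; _+_; _≤_)
open import Data.Nat.Base using (_≡ᵇ_)
open import Data.Bool.Properties using (∨-comm)
open import Data.Product using (_×_)
open import Relation.Binary.PropositionalEquality using (refl)
open import Data.Bool using (Bool; true; false; _∨_; if_then_else_)
open import Data.Fin using (Fin; toℕ)
open import Data.Vec.Functional using (foldr)
open import Relation.Binary.PropositionalEquality using (_≡_)

record Graph (n : ℕ) : Set where
  field
    adj     : Fin n → Fin n → Bool
    sym     : ∀ u v → adj u v ≡ adj v u
    irrefl  : ∀ v → adj v v ≡ false
open Graph public

Σfin : ∀ {n} → (Fin n → ℕ) → ℕ
Σfin {n} g = foldr _+_ 0 g

Label : Set
Label = Fin 3

val : Label → ℕ
val = toℕ

nbrSum : ∀ {n} → Graph n → (Fin n → Label) → Fin n → ℕ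
nbrSum G f v = Σfin (λ u → if adj G v u then val (f u) else 0)

weight : ∀ {n} → (Fin n → Label) → ℕ
weight f = Σfin (λ u → val (f u))

-- perfect Italian dominating function
IsPID : ∀ {n} → Graph n → (Fin n → Label) → Set
IsPID G f = ∀ v → val (f v) ≡ 0 → nbrSum G f v ≡ 2

-- γ^p_I(G)-function: a PID-function of minimum weight
IsMinPID : ∀ {n} → Graph n → (Fin n → Label) → Set
IsMinPID G f = IsPID G f × (∀ g → IsPID G g → weight f ≤ weight g)

pathAdj : ∀ {n} → Fin n → Fin n → Bool
pathAdj i j = (suc (toℕ i) ≡ᵇ toℕ j) ∨ (suc (toℕ j) ≡ᵇ toℕ i)

private
  sn≢n : ∀ m → (suc m ≡ᵇ m) ≡ false
  sn≢n zero = refl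
  sn≢n (suc m) = sn≢n m

pathAdj-sym : ∀ {n} (i j : Fin n) → pathAdj i j ≡ pathAdj j i
pathAdj-sym i j = ∨-comm (suc (toℕ i) ≡ᵇ toℕ j) (suc (toℕ j) ≡ᵇ toℕ i)

pathAdj-irrefl : ∀ {n} (i : Fin n) → pathAdj i i ≡ false
pathAdj-irrefl i rewrite sn≢n (toℕ i) = refl

P : (n : ℕ) → Graph n
P n = record { adj = pathAdj ; sym = pathAdj-sym ; irrefl = pathAdj-irrefl }

module Submission where

-- We first replace
-- the graph-theoretic neighbour sum on P_n by a recursive one on "segments":
-- the PID condition for a segment whose left outside neighbour carries a
-- label a unfolds vertex by vertex into a local condition on consecutive
-- triples (a, b, c).
--
-- A potential on consecutive pairs, potential a b = a + 2b
-- except potential 0 2 = 3, satisfies under the local PID condition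
--   potential b c + 1 ≤ potential a b + 2c,
-- so it telescopes along the path to 2 · weight g ≥ n + 1 for every PID g.
--
-- Upper bound.  The labelling 1 0 1 0 … 1 (ending in 1 1 when n is even) is a
-- PID-function with 2 · weight ≤ n + 2 and no label 2.  By parity the two
-- bounds force it to be of minimum weight.

open import Defs
open import Data.Nat using (ℕ; _≥_)
open import Data.Fin using (Fin)
open import Data.Product using (Σ; _×_)
open import Relation.Binary.PropositionalEquality using (_≢_)

open import Data.Nat using (zero; suc; _+_; _*_; _≤_; _<_; _≤?_; z≤n; s≤s)
open import Data.Nat.Properties
  using (≤-refl; ≤-trans; m≤m+n; +-monoˡ-≤; +-assoc; +-identityʳ; *-distribˡ-+; *-cancelˡ-<; m<1+n⇒m≤n)
open import Data.Fin using () renaming (zero to fz; suc to fs)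
open import Data.Vec.Functional using (tail)
open import Data.Product using (_,_)
open import Relation.Binary.PropositionalEquality using (_≡_; refl; trans; cong) renaming (sym to ≡-sym)
open import Relation.Nullary.Decidable using (True; toWitness)

≤-by-evaluation : ∀ {m n} → {m≤?n : True (m ≤? n)} → m ≤ n
≤-by-evaluation {m≤?n = m≤?n} = toWitness m≤?n

Σfin-zero : ∀ n → Σfin {n} (λ _ → 0) ≡ 0
Σfin-zero zero = refl
Σfin-zero (suc n) = Σfin-zero n

zeroL oneL : Label
zeroL = fz
oneL = fs fz

firstVal : ∀ {n} → (Fin n → Label) → ℕ
firstVal {zero} f = 0
firstVal {suc n} f = val (f fz)

-- For a path segment f whose left outside neighbour has label a (and with no
-- right outside neighbour), segNbr a f v is the sum of the labels around v.
segNbr : ∀ {n} → Label → (Fin n → Label) → Fin n → ℕ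
segNbr a f fz = val a + firstVal (tail f)
segNbr a f (fs v) = segNbr (f fz) (tail f) v

SegPID : ∀ {n} → Label → (Fin n → Label) → Set
SegPID a f = ∀ v → val (f v) ≡ 0 → segNbr a f v ≡ 2

-- On the whole path P_n the neighbour sum is the segment neighbour sum with
-- an empty (label 0) left outside neighbour.
nbrSum-path : ∀ {n} (f : Fin n → Label) v → nbrSum (P n) f v ≡ segNbr zeroL f v
nbrSum-path {suc zero} f fz = refl
nbrSum-path {suc (suc n)} f fz = trans (cong (val (f (fs fz)) +_) (Σfin-zero n)) (+-identityʳ _)
nbrSum-path f (fs fz) = cong (val (f fz) +_) (nbrSum-path (tail f) fz)
nbrSum-path f (fs (fs v)) = nbrSum-path (tail f) (fs v)

isPID⇒segPID : ∀ {n} (f : Fin n → Label) → IsPID (P n) f → SegPID zeroL f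
isPID⇒segPID f pid v f[v]≡0 = trans (≡-sym (nbrSum-path f v)) (pid v f[v]≡0)

segPID⇒isPID : ∀ {n} (f : Fin n → Label) → SegPID zeroL f → IsPID (P n) f
segPID⇒isPID f seg v f[v]≡0 = trans (nbrSum-path f v) (seg v f[v]≡0)

Valid : Label → Label → Label → Set
Valid a b c = val b ≡ 0 → val a + val c ≡ 2

potential : Label → Label → ℕ
potential fz (fs (fs fz)) = 3
potential a b = val a + 2 * val b

potential-paid : ∀ a b → suc (val (fs b)) ≤ potential a (fs b)
potential-paid fz fz = ≤-by-evaluation
potential-paid fz (fs fz) = ≤-by-evaluation
potential-paid (fs fz) fz = ≤-by-evaluation
potential-paid (fs fz) (fs fz) = ≤-by-evaluation
potential-paid (fs (fs fz)) fz = ≤-by-evaluation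
potential-paid (fs (fs fz)) (fs fz) = ≤-by-evaluation

potential-start : ∀ b → potential zeroL b ≤ 2 * val b
potential-start fz = ≤-by-evaluation
potential-start (fs fz) = ≤-by-evaluation
potential-start (fs (fs fz)) = ≤-by-evaluation

potential-step : ∀ a b c → Valid a b c → suc (potential b c) ≤ potential a b + 2 * val c
potential-step a (fs b) c _ = +-monoˡ-≤ (2 * val c) (potential-paid a b)
potential-step a fz c valid = zeroVertex a c (valid refl)
  where
  zeroVertex : ∀ a c → val a + val c ≡ 2 → suc (potential zeroL c) ≤ potential a zeroL + 2 * val c
  zeroVertex fz fz ()
  zeroVertex fz (fs fz) ()
  zeroVertex fz (fs (fs fz)) refl = ≤-by-evaluation
  zeroVertex (fs fz) fz ()
  zeroVertex (fs fz) (fs fz) refl = ≤-by-evaluation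
  zeroVertex (fs fz) (fs (fs fz)) ()
  zeroVertex (fs (fs fz)) fz refl = ≤-by-evaluation
  zeroVertex (fs (fs fz)) (fs fz) ()
  zeroVertex (fs (fs fz)) (fs (fs fz)) ()

potential-end : ∀ a b → Valid a b zeroL → 2 ≤ potential a b
potential-end a (fs b) _ = ≤-trans (s≤s (s≤s z≤n)) (potential-paid a b)
potential-end a fz valid = lastZero a (valid refl)
  where
  lastZero : ∀ a → val a + 0 ≡ 2 → 2 ≤ potential a zeroL
  lastZero (fs (fs fz)) refl = ≤-refl

potential-telescope : ∀ m a (f : Fin (suc m) → Label) → SegPID a f →
  2 + m ≤ potential a (f fz) + 2 * weight (tail f)
potential-telescope zero a f seg =
  ≤-trans (potential-end a (f fz) (seg fz)) (m≤m+n _ _)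
potential-telescope (suc m) a f seg = begin
  suc (2 + m)                                          ≤⟨ s≤s (potential-telescope m b (tail f) (λ v → seg (fs v))) ⟩
  suc (potential b c) + 2 * W                          ≤⟨ +-monoˡ-≤ (2 * W) (potential-step a b c (seg fz)) ⟩
  potential a b + 2 * val c + 2 * W                    ≡⟨ +-assoc (potential a b) (2 * val c) (2 * W) ⟩
  potential a b + (2 * val c + 2 * W)                  ≡⟨ cong (potential a b +_) (≡-sym (*-distribˡ-+ 2 (val c) W)) ⟩
  potential a b + 2 * (val c + W)                      ∎
  where
  open Data.Nat.Properties.≤-Reasoning
  b = f fz
  c = f (fs fz)
  W = weight (tail (tail f))

pid-lowerBound : ∀ m (g : Fin (suc m) → Label) → IsPID (P (suc m)) g → 2 + m ≤ 2 * weight g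
pid-lowerBound m g pid = begin
  2 + m                                ≤⟨ potential-telescope m zeroL g (isPID⇒segPID g pid) ⟩
  potential zeroL (g fz) + 2 * W       ≤⟨ +-monoˡ-≤ (2 * W) (potential-start (g fz)) ⟩
  2 * val (g fz) + 2 * W               ≡⟨ ≡-sym (*-distribˡ-+ 2 (val (g fz)) W) ⟩
  2 * weight g                         ∎
  where
  open Data.Nat.Properties.≤-Reasoning
  W = weight (tail g)

alternating : ∀ m → Fin (suc m) → Label
alternating zero _ = oneL
alternating (suc zero) _ = oneL
alternating (suc (suc m)) fz = oneL
alternating (suc (suc m)) (fs fz) = zeroL
alternating (suc (suc m)) (fs (fs v)) = alternating m v

alternating-first : ∀ m → alternating m fz ≡ oneL
alternating-first zero = refl
alternating-first (suc zero) = refl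
alternating-first (suc (suc m)) = refl

alternating-segPID : ∀ m a → SegPID a (alternating m)
alternating-segPID zero a fz ()
alternating-segPID (suc zero) a fz ()
alternating-segPID (suc zero) a (fs fz) ()
alternating-segPID (suc (suc m)) a fz ()
alternating-segPID (suc (suc m)) a (fs fz) _ = cong (λ l → 1 + val l) (alternating-first m)
alternating-segPID (suc (suc m)) a (fs (fs v)) = alternating-segPID m zeroL v

alternating-weight : ∀ m → 2 * weight (alternating m) ≤ 3 + m
alternating-weight zero = ≤-by-evaluation
alternating-weight (suc zero) = ≤-by-evaluation
alternating-weight (suc (suc m)) = begin
  2 * (1 + W)   ≡⟨ *-distribˡ-+ 2 1 W ⟩
  2 + 2 * W     ≤⟨ s≤s (s≤s (alternating-weight m)) ⟩
  3 + suc (suc m) ∎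
  where
  open Data.Nat.Properties.≤-Reasoning
  W = weight (alternating m)

alternating-no2 : ∀ m v → val (alternating m v) ≢ 2
alternating-no2 zero _ ()
alternating-no2 (suc zero) _ ()
alternating-no2 (suc (suc m)) fz ()
alternating-no2 (suc (suc m)) (fs fz) ()
alternating-no2 (suc (suc m)) (fs (fs v)) = alternating-no2 m v

halve-≤ : ∀ a b m → 2 * a ≤ 3 + m → 2 + m ≤ 2 * b → a ≤ b
halve-≤ a b m upper lower = m<1+n⇒m≤n (*-cancelˡ-< 2 a (suc b) 2a<2[1+b])
  where
  2a<2[1+b] : 2 * a < 2 * suc b
  2a<2[1+b] = begin-strict
    2 * a        ≤⟨ upper ⟩
    3 + m        ≤⟨ s≤s lower ⟩
    suc (2 * b)  <⟨ ≤-refl ⟩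
    2 + 2 * b    ≡⟨ ≡-sym (*-distribˡ-+ 2 1 b) ⟩
    2 * suc b    ∎
    where open Data.Nat.Properties.≤-Reasoning

lemma2p2 : (n : ℕ) → n ≥ 1 →
    Σ (Fin n → Label) (λ f → IsMinPID (P n) f × (∀ v → val (f v) ≢ 2))
lemma2p2 (suc m) _ = alternating m , (isPID , minimal) , alternating-no2 m
  where
  isPID : IsPID (P (suc m)) (alternating m)
  isPID = segPID⇒isPID (alternating m) (alternating-segPID m zeroL)

  minimal : ∀ g → IsPID (P (suc m)) g → weight (alternating m) ≤ weight g
  minimal g pid = halve-≤ _ _ m (alternating-weight m) (pid-lowerBound m g pid)
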